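{- Let $\mathcal K$ be a simplicial complex with boundary operator $\partial_2$ (from triangles to edges). For any partition $F\cup C$ of the $2$-simplexes of $\mathcal K$, $\boldsymbol\Pi^{\mathrm{up}}_1=\boldsymbol\Pi_{\mathrm{Im}(\partial_2[:,F])}+\boldsymbol\Pi_{\mathrm{Ker}(\partial_2^\top[F,:])}\,\partial_2[:,C]\,\big(\mathrm{Sc}[\mathbf L^{\mathrm{down}}_2]_C\big)^\dagger\,\partial_2^\top[C,:]\,\boldsymbol\Pi_{\mathrm{Ker}(\partial_2^\top[F,:])}$, where $\mathbf L^{\mathrm{down}}_2=\partial_2^\top\partial_2$.
   Context: $\boldsymbol\Pi^{\mathrm{up}}_1=\partial_2(\partial_2^\top\partial_2)^\dagger\partial_2^\top$ is the orthogonal projection onto $\mathrm{Im}(\partial_2)$; $\boldsymbol\Pi_V$ denotes the orthogonal projection onto a subspace $V$. $\partial_2[:,F]$ is the submatrix of columns indexed by $F$, and $\partial_2^\top[F,:]$ the submatrix of $\partial_2^\top$ with rows indexed by $F$. $\dagger$ is the Moore–Penrose pseudo-inverse and $\mathrm{Sc}[\mathbf A]_C=\mathbf A[C,C]-\mathbf A[C,F]\mathbf A[F,F]^\dagger\mathbf A[F,C]$. -}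

module Defs where

open import Data.Nat using (ℕ; zero; suc)
open import Data.Fin using (Fin; zero; suc; _<_; _≟_)
open import Data.Rational using (ℚ; 0ℚ; 1ℚ; _+_; _*_; _-_; -_)
open import Data.Product using (Σ; _×_; ∃; _,_)
open import Data.Sum using (_⊎_; inj₁; inj₂; [_,_])
open import Relation.Binary.PropositionalEquality using (_≡_)
open import Relation.Nullary using (yes; no; _×-dec_)
open import Function.Definitions using (Injective; Surjective)

Vect : ℕ → Set
Vect n = Fin n → ℚ

Mat : ℕ → ℕ → Set
Mat m n = Fin m → Fin n → ℚ

∑ : {n : ℕ} → (Fin n → ℚ) → ℚ
∑ {zero}  f = 0ℚ
∑ {suc n} f = f zero + ∑ (λ i → f (suc i))

_·_ : {m n k : ℕ} → Mat m n → Mat n k → Mat m k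
(A · B) i j = ∑ (λ l → A i l * B l j)

infixl 7 _·_
infixl 6 _⊕_ _⊖_
infix 4 _≈M_ _≈V_
infix 10 _ᵀ

_⊕_ : {m n : ℕ} → Mat m n → Mat m n → Mat m n
(A ⊕ B) i j = A i j + B i j

_⊖_ : {m n : ℕ} → Mat m n → Mat m n → Mat m n
(A ⊖ B) i j = A i j - B i j

_ᵀ : {m n : ℕ} → Mat m n → Mat n m
(A ᵀ) i j = A j i

apply : {m n : ℕ} → Mat m n → Vect n → Vect m
apply A x i = ∑ (λ j → A i j * x j)

dot : {n : ℕ} → Vect n → Vect n → ℚ
dot x y = ∑ (λ i → x i * y i)

_≈M_ : {m n : ℕ} → Mat m n → Mat m n → Set
A ≈M B = ∀ i j → A i j ≡ B i j

_≈V_ : {n : ℕ} → Vect n → Vect n → Set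
x ≈V y = ∀ i → x i ≡ y i

-- Moore–Penrose pseudo-inverse (the four Penrose conditions; unique)
IsPinv : {m n : ℕ} → Mat m n → Mat n m → Set
IsPinv A X = (A · X · A ≈M A) × (X · A · X ≈M X)
           × ((A · X) ᵀ ≈M A · X) × ((X · A) ᵀ ≈M X · A)

Im : {m n : ℕ} → Mat m n → Vect m → Set
Im A v = ∃ λ x → apply A x ≈V v

Ker : {m n : ℕ} → Mat m n → Vect n → Set
Ker A v = ∀ i → apply A v i ≡ 0ℚ

IsOrthProj : {n : ℕ} → Mat n n → (Vect n → Set) → Set
IsOrthProj P V = (∀ x → V (apply P x))
               × (∀ v → V v → apply P v ≈V v)
               × (∀ x y → V y → dot (λ i → x i - apply P x i) y ≡ 0ℚ)

sub : {m n p q : ℕ} → Mat m n → (Fin p → Fin m) → (Fin q → Fin n) → Mat p q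
sub A R S i j = A (R i) (S j)

cols : {m n q : ℕ} → Mat m n → (Fin q → Fin n) → Mat m q
cols A S i j = A i (S j)

rows : {m n p : ℕ} → Mat m n → (Fin p → Fin m) → Mat p n
rows A R i j = A (R i) j

-- Schur complement Sc[A]_C = A[C,C] - A[C,F] A[F,F]^† A[F,C],
-- given a pseudo-inverse Y of A[F,F]
Sc : {t p q : ℕ} → Mat t t → (Fin p → Fin t) → (Fin q → Fin t) → Mat p p → Mat q q
Sc A F C Y = sub A C C ⊖ (sub A C F · Y · sub A F C)

-- Simplicial complexes (up to dimension 2) on vertex set Fin n.
-- Edges are [a,b] with a < b, triangles [a,b,c] with a < b < c,
-- all distinct, and every face of a triangle is an edge.

record Complex : Set where
  field
    nV nE nT : ℕ
    e₀ e₁ : Fin nE → Fin nV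
    e-ord : ∀ e → e₀ e < e₁ e
    e-inj : ∀ e e′ → e₀ e ≡ e₀ e′ → e₁ e ≡ e₁ e′ → e ≡ e′
    t₀ t₁ t₂ : Fin nT → Fin nV
    t-ord₀₁ : ∀ τ → t₀ τ < t₁ τ
    t-ord₁₂ : ∀ τ → t₁ τ < t₂ τ
    t-inj : ∀ τ τ′ → t₀ τ ≡ t₀ τ′ → t₁ τ ≡ t₁ τ′ → t₂ τ ≡ t₂ τ′ → τ ≡ τ′
    face₁₂ : ∀ τ → ∃ λ e → (e₀ e ≡ t₁ τ) × (e₁ e ≡ t₂ τ)
    face₀₂ : ∀ τ → ∃ λ e → (e₀ e ≡ t₀ τ) × (e₁ e ≡ t₂ τ)
    face₀₁ : ∀ τ → ∃ λ e → (e₀ e ≡ t₀ τ) × (e₁ e ≡ t₁ τ)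

open Complex public

-- boundary operator ∂₂ : C₂ → C₁ in the standard bases,
-- ∂[a,b,c] = [b,c] - [a,c] + [a,b]
∂₂ : (K : Complex) → Mat (nE K) (nT K)
∂₂ K e τ with (e₀ K e ≟ t₁ K τ) ×-dec (e₁ K e ≟ t₂ K τ)
... | yes _ = 1ℚ
... | no _ with (e₀ K e ≟ t₀ K τ) ×-dec (e₁ K e ≟ t₂ K τ)
...   | yes _ = - 1ℚ
...   | no _ with (e₀ K e ≟ t₀ K τ) ×-dec (e₁ K e ≟ t₁ K τ)
...     | yes _ = 1ℚ
...     | no _ = 0ℚ

Ldown₂ : (K : Complex) → Mat (nT K) (nT K)
Ldown₂ K = ∂₂ K ᵀ · ∂₂ K

-- F ∪ C is a partition of the triangles: [F , C] : Fin p ⊎ Fin q → Fin nT bijective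
IsPartition : {t p q : ℕ} → (Fin p → Fin t) → (Fin q → Fin t) → Set
IsPartition F C = Injective _≡_ _≡_ [ F , C ] × Surjective _≡_ _≡_ [ F , C ]

{-# OPTIONS --safe #-}
-- Write B = ∂₂, B_F = B[:,F], B_C = B[:,C].  Both B (BᵀB)† Bᵀ y and
-- R y = P₁ y + P₂ B_C Z B_Cᵀ P₂ y lie in (Ker Bᵀ)⊥, on which Bᵀ is injective, so it suffices
-- that Bᵀ R y = Bᵀ y.  On the F-rows this holds since P₁ = B_F (B_FᵀB_F)† B_Fᵀ and P₂ kills
-- them.  On the C-rows, the Schur complement equals B_Cᵀ P₂ B_C, the Gram matrix of P₂ B_C,
-- so its pseudo-inverse Z inverts it on B_Cᵀ P₂ y; then B_Cᵀ R y = B_Cᵀ (P₁ + P₂) y = B_Cᵀ y.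
module Submission where

open import Defs
open import Data.Nat using (ℕ; zero; suc)
open import Data.Fin using (Fin; zero; suc)
open import Data.Rational using (ℚ; 0ℚ; 1ℚ; _+_; _*_; _-_; -_; _≤_; positive; negative)
open import Data.Rational.Properties
open import Data.Rational.Solver using (module +-*-Solver)
open +-*-Solver using (solve; _:=_; _:+_; _:*_; _:-_)
open import Algebra.Bundles using (CommutativeRing)
open import Algebra.Properties.Group +-0-group using () renaming (x∙y⁻¹≈ε⇒x≈y to x-y≡0⇒x≡y)
open import Algebra.Properties.Ring +-*-ring using (-1*x≈-x)
open import Algebra.Properties.Semiring.Sum (CommutativeRing.semiring +-*-commutativeRing)
  using (sum; sum-cong-≗; sum-replicate-zero; ∑-comm; *-distribˡ-sum; *-distribʳ-sum)
  renaming (∑-distrib-+ to sum-distrib-+)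
open import Data.Sum using (inj₁; inj₂; [_,_])
open import Data.Empty using (⊥-elim)
open import Data.Product using (_,_; proj₁; proj₂)
open import Function.Definitions using (Surjective)
open import Relation.Binary using (tri<; tri≈; tri>)
open import Relation.Binary.PropositionalEquality hiding ([_])
open ≡-Reasoning

-- Defs' ∑ unfolds like the library's foldr-based sum, so the library's summation lemmas transfer.
∑≡sum : ∀ {n} (f : Fin n → ℚ) → ∑ f ≡ sum f
∑≡sum {zero}  f = refl
∑≡sum {suc n} f = cong (f zero +_) (∑≡sum (λ i → f (suc i)))

∑-cong : ∀ {n} {f g : Fin n → ℚ} → (∀ i → f i ≡ g i) → ∑ f ≡ ∑ g
∑-cong {f = f} {g} f≗g rewrite ∑≡sum f | ∑≡sum g = sum-cong-≗ f≗g

∑-zero : ∀ {n} {f : Fin n → ℚ} → (∀ i → f i ≡ 0ℚ) → ∑ f ≡ 0ℚ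
∑-zero {n} {f} f≗0 rewrite ∑≡sum f = trans (sum-cong-≗ f≗0) (sum-replicate-zero n)

∑-distrib-+ : ∀ {n} (f g : Fin n → ℚ) → ∑ (λ i → f i + g i) ≡ ∑ f + ∑ g
∑-distrib-+ f g rewrite ∑≡sum f | ∑≡sum g | ∑≡sum (λ i → f i + g i) = sum-distrib-+ f g

*-distribˡ-∑ : ∀ {n} c (f : Fin n → ℚ) → c * ∑ f ≡ ∑ (λ i → c * f i)
*-distribˡ-∑ c f rewrite ∑≡sum f | ∑≡sum (λ i → c * f i) = *-distribˡ-sum c f

*-distribʳ-∑ : ∀ {n} c (f : Fin n → ℚ) → ∑ f * c ≡ ∑ (λ i → f i * c)
*-distribʳ-∑ c f rewrite ∑≡sum f | ∑≡sum (λ i → f i * c) = *-distribʳ-sum c f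

∑-neg : ∀ {n} (f : Fin n → ℚ) → ∑ (λ i → - f i) ≡ - ∑ f
∑-neg f = begin
  ∑ (λ i → - f i)      ≡⟨ ∑-cong (λ i → sym (-1*x≈-x (f i))) ⟩
  ∑ (λ i → - 1ℚ * f i) ≡⟨ *-distribˡ-∑ (- 1ℚ) f ⟨
  - 1ℚ * ∑ f           ≡⟨ -1*x≈-x (∑ f) ⟩
  - ∑ f                ∎

∑-distrib-- : ∀ {n} (f g : Fin n → ℚ) → ∑ (λ i → f i - g i) ≡ ∑ f - ∑ g
∑-distrib-- f g = trans (∑-distrib-+ f (λ i → - g i)) (cong (∑ f +_) (∑-neg g))

∑-swap : ∀ {m n} (f : Fin m → Fin n → ℚ) → ∑ (λ i → ∑ (f i)) ≡ ∑ (λ j → ∑ (λ i → f i j))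
∑-swap f = trans (∑∑≡sumsum f) (trans (∑-comm f) (sym (∑∑≡sumsum (λ j i → f i j))))
  where
  ∑∑≡sumsum : ∀ {m n} (f : Fin m → Fin n → ℚ) → ∑ (λ i → ∑ (f i)) ≡ sum (λ i → sum (f i))
  ∑∑≡sumsum f = trans (∑-cong (λ i → ∑≡sum (f i))) (∑≡sum (λ i → sum (f i)))

basis : ∀ {n} → Fin n → Vect n
basis zero    zero    = 1ℚ
basis zero    (suc _) = 0ℚ
basis (suc _) zero    = 0ℚ
basis (suc j) (suc l) = basis j l

∑-basis : ∀ {n} (f : Fin n → ℚ) j → ∑ (λ l → f l * basis j l) ≡ f j
∑-basis f zero = begin
  f zero * 1ℚ + ∑ (λ l → f (suc l) * 0ℚ) ≡⟨ cong₂ _+_ (*-identityʳ (f zero)) (∑-zero (λ l → *-zeroʳ (f (suc l)))) ⟩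
  f zero + 0ℚ                            ≡⟨ +-identityʳ (f zero) ⟩
  f zero                                 ∎
∑-basis f (suc j) = begin
  f zero * 0ℚ + ∑ (λ l → f (suc l) * basis j l) ≡⟨ cong₂ _+_ (*-zeroʳ (f zero)) (∑-basis (λ l → f (suc l)) j) ⟩
  0ℚ + f (suc j)                                ≡⟨ +-identityˡ (f (suc j)) ⟩
  f (suc j)                                     ∎

infixl 6 _+ᵥ_ _-ᵥ_

_+ᵥ_ : ∀ {n} → Vect n → Vect n → Vect n
(x +ᵥ y) i = x i + y i

_-ᵥ_ : ∀ {n} → Vect n → Vect n → Vect n
(x -ᵥ y) i = x i - y i

apply-cong : ∀ {m n} (A : Mat m n) {x y : Vect n} → x ≈V y → apply A x ≈V apply A y
apply-cong A x≈y i = ∑-cong (λ j → cong (A i j *_) (x≈y j))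

apply-≈M : ∀ {m n} {A B : Mat m n} → A ≈M B → ∀ x → apply A x ≈V apply B x
apply-≈M A≈B x i = ∑-cong (λ j → cong (_* x j) (A≈B i j))

apply-basis : ∀ {m n} (A : Mat m n) i j → apply A (basis j) i ≡ A i j
apply-basis A i j = ∑-basis (A i) j

≈M-from-apply : ∀ {m n} {A B : Mat m n} → (∀ x → apply A x ≈V apply B x) → A ≈M B
≈M-from-apply {A = A} {B} Ax≈Bx i j =
  trans (sym (apply-basis A i j)) (trans (Ax≈Bx (basis j) i) (apply-basis B i j))

apply-+ᵥ : ∀ {m n} (A : Mat m n) x y → apply A (x +ᵥ y) ≈V apply A x +ᵥ apply A y
apply-+ᵥ A x y i = trans (∑-cong (λ j → *-distribˡ-+ (A i j) (x j) (y j)))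
  (∑-distrib-+ (λ j → A i j * x j) (λ j → A i j * y j))

apply--ᵥ : ∀ {m n} (A : Mat m n) x y → apply A (x -ᵥ y) ≈V apply A x -ᵥ apply A y
apply--ᵥ A x y i = trans
  (∑-cong (λ j → solve 3 (λ a b c → a :* (b :- c) := a :* b :- a :* c) refl (A i j) (x j) (y j)))
  (∑-distrib-- (λ j → A i j * x j) (λ j → A i j * y j))

apply-⊕ : ∀ {m n} (A B : Mat m n) x → apply (A ⊕ B) x ≈V apply A x +ᵥ apply B x
apply-⊕ A B x i = trans (∑-cong (λ j → *-distribʳ-+ (x j) (A i j) (B i j)))
  (∑-distrib-+ (λ j → A i j * x j) (λ j → B i j * x j))

apply-⊖ : ∀ {m n} (A B : Mat m n) x → apply (A ⊖ B) x ≈V apply A x -ᵥ apply B x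
apply-⊖ A B x i = trans
  (∑-cong (λ j → solve 3 (λ a b c → (a :- b) :* c := a :* c :- b :* c) refl (A i j) (B i j) (x j)))
  (∑-distrib-- (λ j → A i j * x j) (λ j → B i j * x j))

apply-· : ∀ {m n k} (A : Mat m n) (B : Mat n k) x → apply (A · B) x ≈V apply A (apply B x)
apply-· A B x i = begin
  ∑ (λ j → ∑ (λ l → A i l * B l j) * x j)   ≡⟨ ∑-cong (λ j → *-distribʳ-∑ (x j) (λ l → A i l * B l j)) ⟩
  ∑ (λ j → ∑ (λ l → A i l * B l j * x j))   ≡⟨ ∑-swap (λ j l → A i l * B l j * x j) ⟩
  ∑ (λ l → ∑ (λ j → A i l * B l j * x j))   ≡⟨ ∑-cong (λ l → ∑-cong (λ j → *-assoc (A i l) (B l j) (x j))) ⟩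
  ∑ (λ l → ∑ (λ j → A i l * (B l j * x j))) ≡⟨ ∑-cong (λ l → *-distribˡ-∑ (A i l) (λ j → B l j * x j)) ⟨
  ∑ (λ l → A i l * ∑ (λ j → B l j * x j))   ∎

dot-comm : ∀ {n} (x y : Vect n) → dot x y ≡ dot y x
dot-comm x y = ∑-cong (λ i → *-comm (x i) (y i))

dot-congˡ : ∀ {n} {x x′ : Vect n} (z : Vect n) → x ≈V x′ → dot x z ≡ dot x′ z
dot-congˡ z x≈x′ = ∑-cong (λ i → cong (_* z i) (x≈x′ i))

dot-congʳ : ∀ {n} (x : Vect n) {z z′ : Vect n} → z ≈V z′ → dot x z ≡ dot x z′
dot-congʳ x z≈z′ = ∑-cong (λ i → cong (x i *_) (z≈z′ i))

dot-zeroˡ : ∀ {n} {x : Vect n} (z : Vect n) → (∀ i → x i ≡ 0ℚ) → dot x z ≡ 0ℚ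
dot-zeroˡ z x≗0 = ∑-zero (λ i → trans (cong (_* z i) (x≗0 i)) (*-zeroˡ (z i)))

dot-zeroʳ : ∀ {n} (x : Vect n) {z : Vect n} → (∀ i → z i ≡ 0ℚ) → dot x z ≡ 0ℚ
dot-zeroʳ x {z} z≗0 = trans (dot-comm x z) (dot-zeroˡ x z≗0)

dot-+ᵥˡ : ∀ {n} (x y z : Vect n) → dot (x +ᵥ y) z ≡ dot x z + dot y z
dot-+ᵥˡ x y z = trans (∑-cong (λ i → *-distribʳ-+ (z i) (x i) (y i)))
  (∑-distrib-+ (λ i → x i * z i) (λ i → y i * z i))

dot--ᵥˡ : ∀ {n} (x y z : Vect n) → dot (x -ᵥ y) z ≡ dot x z - dot y z
dot--ᵥˡ x y z = trans
  (∑-cong (λ i → solve 3 (λ a b c → (a :- b) :* c := a :* c :- b :* c) refl (x i) (y i) (z i)))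
  (∑-distrib-- (λ i → x i * z i) (λ i → y i * z i))

dot-ᵀ : ∀ {m n} (A : Mat m n) x y → dot x (apply A y) ≡ dot (apply (A ᵀ) x) y
dot-ᵀ A x y = begin
  ∑ (λ i → x i * ∑ (λ j → A i j * y j))   ≡⟨ ∑-cong (λ i → *-distribˡ-∑ (x i) (λ j → A i j * y j)) ⟩
  ∑ (λ i → ∑ (λ j → x i * (A i j * y j))) ≡⟨ ∑-swap (λ i j → x i * (A i j * y j)) ⟩
  ∑ (λ j → ∑ (λ i → x i * (A i j * y j))) ≡⟨ ∑-cong (λ j → ∑-cong (λ i → rearrange (x i) (A i j) (y j))) ⟩
  ∑ (λ j → ∑ (λ i → A i j * x i * y j))   ≡⟨ ∑-cong (λ j → *-distribʳ-∑ (y j) (λ i → A i j * x i)) ⟨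
  ∑ (λ j → ∑ (λ i → A i j * x i) * y j)   ∎
  where
  rearrange : ∀ a b c → a * (b * c) ≡ b * a * c
  rearrange = solve 3 (λ a b c → a :* (b :* c) := b :* a :* c) refl

0≤x*x : ∀ x → 0ℚ ≤ x * x
0≤x*x x with <-cmp x 0ℚ
... | tri< x<0 _ _ = <⇒≤ (positive⁻¹ (x * x) {{neg*neg⇒pos x {{negative x<0}} x {{negative x<0}}}})
... | tri≈ _ refl _ = ≤-refl
... | tri> _ _ 0<x = <⇒≤ (positive⁻¹ (x * x) {{pos*pos⇒pos x {{positive 0<x}} x {{positive 0<x}}}})

x*x≡0⇒x≡0 : ∀ x → x * x ≡ 0ℚ → x ≡ 0ℚ
x*x≡0⇒x≡0 x x*x≡0 with <-cmp x 0ℚ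
... | tri< x<0 _ _ = ⊥-elim (<-irrefl (sym x*x≡0) (positive⁻¹ (x * x) {{neg*neg⇒pos x {{negative x<0}} x {{negative x<0}}}}))
... | tri≈ _ x≡0 _ = x≡0
... | tri> _ _ 0<x = ⊥-elim (<-irrefl (sym x*x≡0) (positive⁻¹ (x * x) {{pos*pos⇒pos x {{positive 0<x}} x {{positive 0<x}}}}))

x+y≡0⇒x≡0 : ∀ {x y} → 0ℚ ≤ x → 0ℚ ≤ y → x + y ≡ 0ℚ → x ≡ 0ℚ
x+y≡0⇒x≡0 {x} 0≤x 0≤y x+y≡0 =
  ≤-antisym (subst₂ _≤_ (+-identityʳ x) x+y≡0 (+-monoʳ-≤ x 0≤y)) 0≤x

0≤dot-self : ∀ {n} (x : Vect n) → 0ℚ ≤ dot x x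
0≤dot-self {zero}  x = ≤-refl
0≤dot-self {suc n} x = +-mono-≤ (0≤x*x (x zero)) (0≤dot-self (λ i → x (suc i)))

dot-self≡0⇒≡0 : ∀ {n} (x : Vect n) → dot x x ≡ 0ℚ → ∀ i → x i ≡ 0ℚ
dot-self≡0⇒≡0 {suc n} x x·x≡0 = λ
  { zero    → x*x≡0⇒x≡0 (x zero) head≡0
  ; (suc i) → dot-self≡0⇒≡0 (λ j → x (suc j)) tail≡0 i }
  where
  tail = λ j → x (suc j)
  head≡0 : x zero * x zero ≡ 0ℚ
  head≡0 = x+y≡0⇒x≡0 (0≤x*x (x zero)) (0≤dot-self tail) x·x≡0
  tail≡0 : dot tail tail ≡ 0ℚ
  tail≡0 = begin
    dot tail tail                   ≡⟨ +-identityˡ (dot tail tail) ⟨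
    0ℚ + dot tail tail              ≡⟨ cong (_+ dot tail tail) head≡0 ⟨
    x zero * x zero + dot tail tail ≡⟨ x·x≡0 ⟩
    0ℚ                              ∎

≈V-by-dot-self : ∀ {n} {x y : Vect n} → dot (x -ᵥ y) (x -ᵥ y) ≡ 0ℚ → x ≈V y
≈V-by-dot-self {x = x} {y} d·d≡0 i = x-y≡0⇒x≡y (x i) (y i) (dot-self≡0⇒≡0 (x -ᵥ y) d·d≡0 i)

infix 4 _⊥_

_⊥_ : ∀ {n} → Vect n → (Vect n → Set) → Set
x ⊥ V = ∀ k → V k → dot x k ≡ 0ℚ

⊥-+ᵥ : ∀ {n} {V : Vect n → Set} {x y : Vect n} → x ⊥ V → y ⊥ V → x +ᵥ y ⊥ V
⊥-+ᵥ {x = x} {y} x⊥V y⊥V k k∈V = begin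
  dot (x +ᵥ y) k    ≡⟨ dot-+ᵥˡ x y k ⟩
  dot x k + dot y k ≡⟨ cong₂ _+_ (x⊥V k k∈V) (y⊥V k k∈V) ⟩
  0ℚ + 0ℚ           ≡⟨ +-identityʳ 0ℚ ⟩
  0ℚ                ∎

Ker--ᵥ : ∀ {m n} (A : Mat m n) {x y : Vect n} → Ker A x → Ker A y → Ker A (x -ᵥ y)
Ker--ᵥ A {x} {y} Ax≡0 Ay≡0 i = begin
  apply A (x -ᵥ y) i          ≡⟨ apply--ᵥ A x y i ⟩
  apply A x i - apply A y i   ≡⟨ cong₂ _-_ (Ax≡0 i) (Ay≡0 i) ⟩
  0ℚ - 0ℚ                     ≡⟨ +-inverseʳ 0ℚ ⟩
  0ℚ                          ∎

Im⊥Kerᵀ : ∀ {m n} (A : Mat m n) {v : Vect m} → Im A v → v ⊥ Ker (A ᵀ)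
Im⊥Kerᵀ A {v} (x , Ax≈v) k Aᵀk≡0 = begin
  dot v k               ≡⟨ dot-congˡ k Ax≈v ⟨
  dot (apply A x) k     ≡⟨ dot-comm (apply A x) k ⟩
  dot k (apply A x)     ≡⟨ dot-ᵀ A k x ⟩
  dot (apply (A ᵀ) k) x ≡⟨ dot-zeroˡ x Aᵀk≡0 ⟩
  0ℚ                    ∎

Kerᵀ⊥Im : ∀ {m n} (A : Mat m n) {u : Vect m} → Ker (A ᵀ) u → u ⊥ Im A
Kerᵀ⊥Im A {u} Aᵀu≡0 k k∈ImA = trans (dot-comm u k) (Im⊥Kerᵀ A k∈ImA u Aᵀu≡0)

ᵀ-injective-on-⊥Kerᵀ : ∀ {m n} (A : Mat m n) {u v : Vect m} → u ⊥ Ker (A ᵀ) → v ⊥ Ker (A ᵀ)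
  → apply (A ᵀ) u ≈V apply (A ᵀ) v → u ≈V v
ᵀ-injective-on-⊥Kerᵀ A {u} {v} u⊥ v⊥ Aᵀu≈Aᵀv = ≈V-by-dot-self (begin
  dot (u -ᵥ v) d        ≡⟨ dot--ᵥˡ u v d ⟩
  dot u d - dot v d     ≡⟨ cong₂ _-_ (u⊥ d d∈Ker) (v⊥ d d∈Ker) ⟩
  0ℚ - 0ℚ               ≡⟨ +-inverseʳ 0ℚ ⟩
  0ℚ                    ∎)
  where
  d = u -ᵥ v
  d∈Ker : Ker (A ᵀ) d
  d∈Ker i = trans (apply--ᵥ (A ᵀ) u v i)
    (trans (cong (_- apply (A ᵀ) v i) (Aᵀu≈Aᵀv i)) (+-inverseʳ (apply (A ᵀ) v i)))

module OrthProj {n} (P : Mat n n) (V : Vect n → Set) (P-proj : IsOrthProj P V) where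

  private
    residual⊥ : ∀ w → w -ᵥ apply P w ⊥ V
    residual⊥ w = proj₂ (proj₂ P-proj) w

  dot-∈V : ∀ w {k} → V k → dot (apply P w) k ≡ dot w k
  dot-∈V w {k} k∈V = sym (x-y≡0⇒x≡y _ _ (trans (sym (dot--ᵥˡ w (apply P w) k)) (residual⊥ w k k∈V)))

  dot-projectʳ : ∀ x y → dot (apply P x) y ≡ dot (apply P x) (apply P y)
  dot-projectʳ x y = begin
    dot (apply P x) y           ≡⟨ dot-comm (apply P x) y ⟩
    dot y (apply P x)           ≡⟨ dot-∈V y (proj₁ P-proj x) ⟨
    dot (apply P y) (apply P x) ≡⟨ dot-comm (apply P y) (apply P x) ⟩
    dot (apply P x) (apply P y) ∎

  selfAdjoint : ∀ x y → dot (apply P x) y ≡ dot x (apply P y)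
  selfAdjoint x y = begin
    dot (apply P x) y           ≡⟨ dot-projectʳ x y ⟩
    dot (apply P x) (apply P y) ≡⟨ dot-∈V x (proj₁ P-proj y) ⟩
    dot x (apply P y)           ∎

  unique : ∀ w r → V (apply P w -ᵥ r) → w -ᵥ r ⊥ V → apply P w ≈V r
  unique w r e∈V w-r⊥V = ≈V-by-dot-self (begin
    dot (apply P w -ᵥ r) e      ≡⟨ dot--ᵥˡ (apply P w) r e ⟩
    dot (apply P w) e - dot r e ≡⟨ cong (_- dot r e) (dot-∈V w e∈V) ⟩
    dot w e - dot r e           ≡⟨ dot--ᵥˡ w r e ⟨
    dot (w -ᵥ r) e              ≡⟨ w-r⊥V e e∈V ⟩
    0ℚ                          ∎)
    where e = apply P w -ᵥ r

  fixes-⊥⊥ : ∀ a → (∀ d → d ⊥ V → dot a d ≡ 0ℚ) → apply P a ≈V a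
  fixes-⊥⊥ a a⊥⊥V i = sym (≈V-by-dot-self {x = a} {apply P a} (begin
    dot (a -ᵥ apply P a) d      ≡⟨ dot--ᵥˡ a (apply P a) d ⟩
    dot a d - dot (apply P a) d ≡⟨ cong₂ _-_ (a⊥⊥V d (residual⊥ a)) Pa·d≡0 ⟩
    0ℚ - 0ℚ                     ≡⟨ +-inverseʳ 0ℚ ⟩
    0ℚ                          ∎) i)
    where
    d = a -ᵥ apply P a
    Pa·d≡0 : dot (apply P a) d ≡ 0ℚ
    Pa·d≡0 = trans (dot-comm (apply P a) d) (residual⊥ a (apply P a) (proj₁ P-proj a))

pinv-orthProj : ∀ {m n} {A : Mat m n} {X : Mat n m} → IsPinv A X → IsOrthProj (A · X) (Im A)
pinv-orthProj {A = A} {X} (AXA≈A , _ , AX-sym , _) = AXx∈ImA , AX-fixes-ImA , residual⊥ImA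
  where
  AXx∈ImA : ∀ x → Im A (apply (A · X) x)
  AXx∈ImA x = apply X x , λ i → sym (apply-· A X x i)

  AX-fixes-ImA : ∀ v → Im A v → apply (A · X) v ≈V v
  AX-fixes-ImA v (z , Az≈v) i = begin
    apply (A · X) v i           ≡⟨ apply-cong (A · X) Az≈v i ⟨
    apply (A · X) (apply A z) i ≡⟨ apply-· (A · X) A z i ⟨
    apply (A · X · A) z i       ≡⟨ apply-≈M AXA≈A z i ⟩
    apply A z i                 ≡⟨ Az≈v i ⟩
    v i                         ∎

  residual⊥ImA : ∀ x → x -ᵥ apply (A · X) x ⊥ Im A
  residual⊥ImA x y y∈ImA = begin
    dot (x -ᵥ apply (A · X) x) y      ≡⟨ dot--ᵥˡ x (apply (A · X) x) y ⟩
    dot x y - dot (apply (A · X) x) y ≡⟨ cong (λ z → dot x y - z) AXx·y≡x·y ⟩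
    dot x y - dot x y                 ≡⟨ +-inverseʳ (dot x y) ⟩
    0ℚ                                ∎
    where
    AXx·y≡x·y : dot (apply (A · X) x) y ≡ dot x y
    AXx·y≡x·y = begin
      dot (apply (A · X) x) y       ≡⟨ dot-congˡ y (apply-≈M AX-sym x) ⟨
      dot (apply ((A · X) ᵀ) x) y   ≡⟨ dot-ᵀ (A · X) x y ⟨
      dot x (apply (A · X) y)       ≡⟨ dot-congʳ x (AX-fixes-ImA y y∈ImA) ⟩
      dot x y                       ∎

IsGram : ∀ {m t} → Mat t t → (Vect t → Vect m) → Set
IsGram L N = ∀ u v → dot (apply L u) v ≡ dot (N u) (N v)

ᵀ·-gram : ∀ {m n} (A : Mat m n) → IsGram (A ᵀ · A) (apply A)
ᵀ·-gram A u v = trans (dot-congˡ v (apply-· (A ᵀ) A u)) (sym (dot-ᵀ A (apply A u) v))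

-- (Im L)⊥ = Ker L = Ker N, and a is orthogonal to Ker N, so a ∈ Im L, which L L† fixes.
gram-pinv-inverseʳ : ∀ {m t} {L X : Mat t t} {N : Vect t → Vect m} → IsPinv L X → IsGram L N
  → ∀ y a → (∀ u → dot a u ≡ dot y (N u)) → apply L (apply X a) ≈V a
gram-pinv-inverseʳ {L = L} {X} {N} X-pinv L-gram y a a≡N*y i =
  trans (sym (apply-· L X a i)) (OrthProj.fixes-⊥⊥ (L · X) (Im L) (pinv-orthProj X-pinv) a a⊥⊥ImL i)
  where
  a⊥⊥ImL : ∀ d → d ⊥ Im L → dot a d ≡ 0ℚ
  a⊥⊥ImL d d⊥ImL = trans (a≡N*y d) (dot-zeroʳ y (dot-self≡0⇒≡0 (N d) Nd·Nd≡0))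
    where
    Nd·Nd≡0 : dot (N d) (N d) ≡ 0ℚ
    Nd·Nd≡0 = begin
      dot (N d) (N d)   ≡⟨ L-gram d d ⟨
      dot (apply L d) d ≡⟨ dot-comm (apply L d) d ⟩
      dot d (apply L d) ≡⟨ d⊥ImL (apply L d) (d , λ _ → refl) ⟩
      0ℚ                ∎

module _ {m n} (A : Mat m n) {Y : Mat n n} (Y-pinv : IsPinv (A ᵀ · A) Y) where

  ᵀ-projIm≈ᵀ : ∀ w → apply (A ᵀ) (apply A (apply Y (apply (A ᵀ) w))) ≈V apply (A ᵀ) w
  ᵀ-projIm≈ᵀ w i = trans (sym (apply-· (A ᵀ) A _ i))
    (gram-pinv-inverseʳ Y-pinv (ᵀ·-gram A) w (apply (A ᵀ) w) (λ u → sym (dot-ᵀ A w u)) i)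

  private
    residual∈Kerᵀ : ∀ w → Ker (A ᵀ) (w -ᵥ apply A (apply Y (apply (A ᵀ) w)))
    residual∈Kerᵀ w i = trans (apply--ᵥ (A ᵀ) w _ i)
      (trans (cong (λ z → apply (A ᵀ) w i - z) (ᵀ-projIm≈ᵀ w i)) (+-inverseʳ (apply (A ᵀ) w i)))

  orthProjIm-formula : ∀ P → IsOrthProj P (Im A) → ∀ w → apply P w ≈V apply A (apply Y (apply (A ᵀ) w))
  orthProjIm-formula P P-proj w = OrthProj.unique P (Im A) P-proj w _ e∈ImA (Kerᵀ⊥Im A (residual∈Kerᵀ w))
    where
    YAᵀw = apply Y (apply (A ᵀ) w)
    e∈ImA : Im A (apply P w -ᵥ apply A YAᵀw)
    e∈ImA with proj₁ P-proj w
    ... | x , Ax≈Pw = x -ᵥ YAᵀw , λ i → trans (apply--ᵥ A x YAᵀw i) (cong (_- apply A YAᵀw i) (Ax≈Pw i))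

  orthProjKerᵀ-formula : ∀ Q → IsOrthProj Q (Ker (A ᵀ)) → ∀ w → apply Q w ≈V w -ᵥ apply A (apply Y (apply (A ᵀ) w))
  orthProjKerᵀ-formula Q Q-proj w =
    OrthProj.unique Q (Ker (A ᵀ)) Q-proj w _ (Ker--ᵥ (A ᵀ) (proj₁ Q-proj w) (residual∈Kerᵀ w)) w-r⊥KerAᵀ
    where
    Πw = apply A (apply Y (apply (A ᵀ) w))
    w-r⊥KerAᵀ : w -ᵥ (w -ᵥ Πw) ⊥ Ker (A ᵀ)
    w-r⊥KerAᵀ k k∈Ker = trans (dot-congˡ k (λ i → solve 2 (λ a b → a :- (a :- b) := b) refl (w i) (Πw i)))
      (Im⊥Kerᵀ A (_ , λ _ → refl) k k∈Ker)

≗-on-partition : ∀ {t p q} {F : Fin p → Fin t} {C : Fin q → Fin t} {f g : Fin t → ℚ}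
  → Surjective _≡_ _≡_ [ F , C ]
  → (∀ i → f (F i) ≡ g (F i)) → (∀ j → f (C j) ≡ g (C j)) → ∀ τ → f τ ≡ g τ
≗-on-partition {f = f} {g} surj onF onC τ with surj τ
... | inj₁ i , hits = subst (λ τ → f τ ≡ g τ) (hits refl) (onF i)
... | inj₂ j , hits = subst (λ τ → f τ ≡ g τ) (hits refl) (onC j)

-- sub (B ᵀ · B) R S and rows (B ᵀ) R are definitionally cols B R ᵀ · cols B S and cols B R ᵀ.
module _ {m t p q} (B : Mat m t) (F : Fin p → Fin t) (C : Fin q → Fin t)
  (Y : Mat p p) (Y-pinv : IsPinv (sub (B ᵀ · B) F F) Y)
  (P₂ : Mat m m) (P₂-proj : IsOrthProj P₂ (Ker (rows (B ᵀ) F))) where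

  private
    BF = cols B F
    BC = cols B C

  Sc-ᵀ·-apply : ∀ u → apply (Sc (B ᵀ · B) F C Y) u ≈V apply (BC ᵀ) (apply P₂ (apply BC u))
  Sc-ᵀ·-apply u i = begin
    apply (BC ᵀ · BC ⊖ BC ᵀ · BF · Y · (BF ᵀ · BC)) u i
      ≡⟨ apply-⊖ (BC ᵀ · BC) (BC ᵀ · BF · Y · (BF ᵀ · BC)) u i ⟩
    apply (BC ᵀ · BC) u i - apply (BC ᵀ · BF · Y · (BF ᵀ · BC)) u i
      ≡⟨ cong₂ _-_ (apply-· (BC ᵀ) BC u i) (apply-·-BF-Y-BFᵀ i) ⟩
    apply (BC ᵀ) v i - apply (BC ᵀ) Πv i
      ≡⟨ apply--ᵥ (BC ᵀ) v Πv i ⟨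
    apply (BC ᵀ) (v -ᵥ Πv) i
      ≡⟨ apply-cong (BC ᵀ) (orthProjKerᵀ-formula BF Y-pinv P₂ P₂-proj v) i ⟨
    apply (BC ᵀ) (apply P₂ v) i ∎
    where
    v = apply BC u
    Πv = apply BF (apply Y (apply (BF ᵀ) v))
    apply-·-BF-Y-BFᵀ : apply (BC ᵀ · BF · Y · (BF ᵀ · BC)) u ≈V apply (BC ᵀ) Πv
    apply-·-BF-Y-BFᵀ i = begin
      apply (BC ᵀ · BF · Y · (BF ᵀ · BC)) u i              ≡⟨ apply-· (BC ᵀ · BF · Y) (BF ᵀ · BC) u i ⟩
      apply (BC ᵀ · BF · Y) (apply (BF ᵀ · BC) u) i        ≡⟨ apply-· (BC ᵀ · BF) Y _ i ⟩
      apply (BC ᵀ · BF) (apply Y (apply (BF ᵀ · BC) u)) i  ≡⟨ apply-· (BC ᵀ) BF _ i ⟩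
      apply (BC ᵀ) (apply BF (apply Y (apply (BF ᵀ · BC) u))) i
        ≡⟨ apply-cong (BC ᵀ) (apply-cong BF (apply-cong Y (apply-· (BF ᵀ) BC u))) i ⟩
      apply (BC ᵀ) Πv i                                    ∎

  Sc-ᵀ·-gram : IsGram (Sc (B ᵀ · B) F C Y) (λ u → apply P₂ (apply BC u))
  Sc-ᵀ·-gram u v = begin
    dot (apply (Sc (B ᵀ · B) F C Y) u) v          ≡⟨ dot-congˡ v (Sc-ᵀ·-apply u) ⟩
    dot (apply (BC ᵀ) (apply P₂ (apply BC u))) v  ≡⟨ dot-ᵀ BC (apply P₂ (apply BC u)) v ⟨
    dot (apply P₂ (apply BC u)) (apply BC v)      ≡⟨ OrthProj.dot-projectʳ P₂ (Ker (BF ᵀ)) P₂-proj (apply BC u) (apply BC v) ⟩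
    dot (apply P₂ (apply BC u)) (apply P₂ (apply BC v)) ∎

module SchurSplitting {m t p q} (B : Mat m t) (F : Fin p → Fin t) (C : Fin q → Fin t)
  (F,C-surjective : Surjective _≡_ _≡_ [ F , C ])
  (X : Mat t t) (X-pinv : IsPinv (B ᵀ · B) X)
  (Y : Mat p p) (Y-pinv : IsPinv (sub (B ᵀ · B) F F) Y)
  (Z : Mat q q) (Z-pinv : IsPinv (Sc (B ᵀ · B) F C Y) Z)
  (P₁ : Mat m m) (P₁-proj : IsOrthProj P₁ (Im (cols B F)))
  (P₂ : Mat m m) (P₂-proj : IsOrthProj P₂ (Ker (rows (B ᵀ) F))) where

  private
    BF = cols B F
    BC = cols B C

  correction : Vect m → Vect m
  correction y = apply P₂ (apply BC (apply Z (apply (BC ᵀ) (apply P₂ y))))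

  Sc-inverseʳ : ∀ y → apply (Sc (B ᵀ · B) F C Y) (apply Z (apply (BC ᵀ) (apply P₂ y)))
                  ≈V apply (BC ᵀ) (apply P₂ y)
  Sc-inverseʳ y =
    gram-pinv-inverseʳ Z-pinv (Sc-ᵀ·-gram B F C Y Y-pinv P₂ P₂-proj) y (apply (BC ᵀ) (apply P₂ y)) λ u →
      trans (sym (dot-ᵀ BC (apply P₂ y) u)) (OrthProj.selfAdjoint P₂ (Ker (BF ᵀ)) P₂-proj y (apply BC u))

  P₁+P₂≈id : ∀ y → apply P₁ y +ᵥ apply P₂ y ≈V y
  P₁+P₂≈id y i = begin
    apply P₁ y i + apply P₂ y i
      ≡⟨ cong₂ _+_ (orthProjIm-formula BF Y-pinv P₁ P₁-proj y i) (orthProjKerᵀ-formula BF Y-pinv P₂ P₂-proj y i) ⟩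
    Πy i + (y i - Πy i)         ≡⟨ solve 2 (λ a b → a :+ (b :- a) := b) refl (Πy i) (y i) ⟩
    y i                         ∎
    where Πy = apply BF (apply Y (apply (BF ᵀ) y))

  splitting-ᵀ : ∀ y → apply (B ᵀ) (apply P₁ y +ᵥ correction y) ≈V apply (B ᵀ) y
  splitting-ᵀ y = ≗-on-partition F,C-surjective onF onC
    where
    onF : ∀ i → apply (BF ᵀ) (apply P₁ y +ᵥ correction y) i ≡ apply (BF ᵀ) y i
    onF i = begin
      apply (BF ᵀ) (apply P₁ y +ᵥ correction y) i               ≡⟨ apply-+ᵥ (BF ᵀ) (apply P₁ y) (correction y) i ⟩
      apply (BF ᵀ) (apply P₁ y) i + apply (BF ᵀ) (correction y) i ≡⟨ cong₂ _+_ BFᵀP₁y≈BFᵀy (proj₁ P₂-proj _ i) ⟩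
      apply (BF ᵀ) y i + 0ℚ                                     ≡⟨ +-identityʳ (apply (BF ᵀ) y i) ⟩
      apply (BF ᵀ) y i                                          ∎
      where
      BFᵀP₁y≈BFᵀy = trans (apply-cong (BF ᵀ) (orthProjIm-formula BF Y-pinv P₁ P₁-proj y) i) (ᵀ-projIm≈ᵀ BF Y-pinv y i)
    onC : ∀ j → apply (BC ᵀ) (apply P₁ y +ᵥ correction y) j ≡ apply (BC ᵀ) y j
    onC j = begin
      apply (BC ᵀ) (apply P₁ y +ᵥ correction y) j                 ≡⟨ apply-+ᵥ (BC ᵀ) (apply P₁ y) (correction y) j ⟩
      apply (BC ᵀ) (apply P₁ y) j + apply (BC ᵀ) (correction y) j ≡⟨ cong (apply (BC ᵀ) (apply P₁ y) j +_) BCᵀcorrection ⟩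
      apply (BC ᵀ) (apply P₁ y) j + apply (BC ᵀ) (apply P₂ y) j   ≡⟨ apply-+ᵥ (BC ᵀ) (apply P₁ y) (apply P₂ y) j ⟨
      apply (BC ᵀ) (apply P₁ y +ᵥ apply P₂ y) j                   ≡⟨ apply-cong (BC ᵀ) (P₁+P₂≈id y) j ⟩
      apply (BC ᵀ) y j                                            ∎
      where
      BCᵀcorrection = trans (sym (Sc-ᵀ·-apply B F C Y Y-pinv P₂ P₂-proj _ j)) (Sc-inverseʳ y j)

  splitting⊥Kerᵀ : ∀ y → apply P₁ y +ᵥ correction y ⊥ Ker (B ᵀ)
  splitting⊥Kerᵀ y = ⊥-+ᵥ {x = apply P₁ y} {correction y} P₁y⊥ correction⊥
    where
    P₁y⊥ : apply P₁ y ⊥ Ker (B ᵀ)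
    P₁y⊥ k Bᵀk≡0 = Im⊥Kerᵀ BF (proj₁ P₁-proj y) k (λ i → Bᵀk≡0 (F i))
    correction⊥ : correction y ⊥ Ker (B ᵀ)
    correction⊥ k Bᵀk≡0 = trans (OrthProj.dot-∈V P₂ (Ker (BF ᵀ)) P₂-proj _ (λ i → Bᵀk≡0 (F i)))
      (Im⊥Kerᵀ BC (_ , λ _ → refl) k (λ j → Bᵀk≡0 (C j)))

  ᵀ·-pinv-splitting : B · X · B ᵀ ≈M P₁ ⊕ P₂ · BC · Z · rows (B ᵀ) C · P₂
  ᵀ·-pinv-splitting = ≈M-from-apply same-action
    where
    same-action : ∀ y → apply (B · X · B ᵀ) y ≈V apply (P₁ ⊕ P₂ · BC · Z · rows (B ᵀ) C · P₂) y
    same-action y i = begin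
      apply (B · X · B ᵀ) y i
        ≡⟨ trans (apply-· (B · X) (B ᵀ) y i) (apply-· B X _ i) ⟩
      apply B XBᵀy i
        ≡⟨ ᵀ-injective-on-⊥Kerᵀ B (Im⊥Kerᵀ B (_ , λ _ → refl)) (splitting⊥Kerᵀ y) BᵀBXBᵀy≈Bᵀsplitting i ⟩
      (apply P₁ y +ᵥ correction y) i
        ≡⟨ cong (apply P₁ y i +_) correction-apply ⟩
      apply P₁ y i + apply (P₂ · BC · Z · rows (B ᵀ) C · P₂) y i
        ≡⟨ apply-⊕ P₁ (P₂ · BC · Z · rows (B ᵀ) C · P₂) y i ⟨
      apply (P₁ ⊕ P₂ · BC · Z · rows (B ᵀ) C · P₂) y i ∎
      where
      XBᵀy = apply X (apply (B ᵀ) y)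
      BᵀBXBᵀy≈Bᵀsplitting : apply (B ᵀ) (apply B XBᵀy) ≈V apply (B ᵀ) (apply P₁ y +ᵥ correction y)
      BᵀBXBᵀy≈Bᵀsplitting τ = trans (ᵀ-projIm≈ᵀ B X-pinv y τ) (sym (splitting-ᵀ y τ))
      correction-apply : correction y i ≡ apply (P₂ · BC · Z · rows (B ᵀ) C · P₂) y i
      correction-apply = sym (begin
        apply (P₂ · BC · Z · rows (B ᵀ) C · P₂) y i                 ≡⟨ apply-· (P₂ · BC · Z · rows (B ᵀ) C) P₂ y i ⟩
        apply (P₂ · BC · Z · rows (B ᵀ) C) (apply P₂ y) i           ≡⟨ apply-· (P₂ · BC · Z) (rows (B ᵀ) C) _ i ⟩
        apply (P₂ · BC · Z) (apply (BC ᵀ) (apply P₂ y)) i           ≡⟨ apply-· (P₂ · BC) Z _ i ⟩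
        apply (P₂ · BC) (apply Z (apply (BC ᵀ) (apply P₂ y))) i     ≡⟨ apply-· P₂ BC _ i ⟩
        correction y i                                              ∎)

lemma4p10 : (K : Complex) (p q : ℕ) (F : Fin p → Fin (nT K)) (C : Fin q → Fin (nT K))
    → IsPartition F C
    → (Ldag : Mat (nT K) (nT K)) → IsPinv (Ldown₂ K) Ldag
    → (Y : Mat p p) → IsPinv (sub (Ldown₂ K) F F) Y
    → (Z : Mat q q) → IsPinv (Sc (Ldown₂ K) F C Y) Z
    → (P₁ : Mat (nE K) (nE K)) → IsOrthProj P₁ (Im (cols (∂₂ K) F))
    → (P₂ : Mat (nE K) (nE K)) → IsOrthProj P₂ (Ker (rows (∂₂ K ᵀ) F))
    → (∂₂ K · Ldag · ∂₂ K ᵀ)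
      ≈M (P₁ ⊕ P₂ · cols (∂₂ K) C · Z · rows (∂₂ K ᵀ) C · P₂)
lemma4p10 K p q F C (_ , F,C-surjective) =
  SchurSplitting.ᵀ·-pinv-splitting (∂₂ K) F C F,C-surjective
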